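{- Let $d\ge 2$, $n\ge0$, let $F\subseteq\mathbb{F}^d$ contain $k$ directions and let ${\bf C}_F=(C_0,\ldots,C_{d-1})$ be a compatible tuple of total orders on $F$. Then the set $S^{d-1}_{n,{\bf C}_F}$ of $d$-permutations of size $n$ admissible with respect to ${\bf C}_F$ is in bijection with the set of $k$-ary trees with $n$ internal nodes.
   Context: A $d$-permutation of size $n$ is a tuple $\boldsymbol{\pi}=(\pi_1,\ldots,\pi_{d-1})$ of permutations of $[n]$; put $\pi_0=\mathrm{id}$. Its points are $(i,\pi_1(i),\ldots,\pi_{d-1}(i))$, $i\in[n]$; $\pi_l(p)$ is the $l$-th coordinate of point $p$ ($l=0,\ldots,d-1$). For distinct points $p,q$, ${\bf dir}(p,q)=(\mathrm{sign}(\pi_0(q)-\pi_0(p)),\ldots,\mathrm{sign}(\pi_{d-1}(q)-\pi_{d-1}(p)))$. $\mathbb{F}^d$ is the set of directions in $\{+1,-1\}^d$ with last entry $-1$. A $2^{d-1}$-ary tree here has every node either a leaf or internal with exactly $2^{d-1}$ children, one labelled by each direction of $\mathbb{F}^d$; $\mathcal{T}_{\bf f}(r)$ is the subtree rooted at the child of $r$ labelled ${\bf f}$. A $k$-ary tree is a rooted tree in which every node has either $0$ or $k$ distinguishable (ordered) children. The max-tree $\gamma^d(\boldsymbol\pi)$: empty $\boldsymbol\pi$ gives a single leaf; otherwise the root corresponds to the point $p_{\max}$ with $\pi_{d-1}(p_{\max})=n$, and the child labelled ${\bf f}\in\mathbb{F}^d$ is the max-tree of the sub-$d$-permutation of points $p'$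 with ${\bf dir}(p_{\max},p')={\bf f}$ (relabelled order-preservingly). Internal nodes correspond bijectively to points. A total order on a set of directions is compatible with respect to axis $k$ if no direction with $k$-th entry $+1$ precedes one with $k$-th entry $-1$; a tuple $(C_0,\ldots,C_{d-1})$ is compatible if each $C_k$ is compatible w.r.t. axis $k$. $\boldsymbol\pi$ is admissible with respect to ${\bf C}_F$ if (i) for every internal node $r$ of $\gamma^d(\boldsymbol\pi)$, every $l\in\{0,\ldots,d-1\}$ and all ${\bf f}_1,{\bf f}_2\in F$ with ${\bf f}_1$ preceding ${\bf f}_2$ in $C_l$, every point corresponding to a node of $\mathcal{T}_{{\bf f}_1}(r)$ has smaller $l$-th coordinate than every point corresponding to a node of $\mathcal{T}_{{\bf f}_2}(r)$; and (ii) there are no internal nodes $r_1,r_2$ with $r_1\in\mathcal{T}_{\bf f}(r_2)$ for some direction ${\bf f}\notin F$. -}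

module Defs where

import Data.Nat
open import Data.Nat using (ℕ; zero; suc; _≤_; _<ᵇ_; _+_)
open import Data.Fin using (Fin; toℕ; fromℕ) renaming (_<_ to _<F_)
open import Data.Vec using (Vec; []; _∷_; lookup; tabulate)
open import Data.List using (List; length)
import Data.List as L
open import Data.List.Membership.Propositional using (_∈_)
open import Data.List.Relation.Unary.All using (All)
open import Data.List.Relation.Unary.Unique.Propositional using (Unique)
open import Data.List.Relation.Binary.Permutation.Propositional using (_↭_)
open import Data.Bool using (if_then_else_)
open import Data.Product using (Σ; ∃-syntax; _×_)
open import Data.Empty using (⊥)
open import Data.Unit using (⊤)
open import Relation.Nullary using (¬_)
open import Relation.Binary.PropositionalEquality using (_≡_; _≢_)
open import Level using () renaming (suc to lsuc; zero to lzero)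

data Sign : Set where
  plus minus : Sign

Dir : ℕ → Set
Dir d = Vec Sign d

IsF : ∀ {d} → Dir d → Set
IsF {zero}  f = ⊥
IsF {suc d} f = lookup f (fromℕ d) ≡ minus

-- d-permutations of size n (raw data): the tuple (π_1,…,π_{d-1}),
-- each π_l given by its vector of values (π_l(1),…,π_l(n)).

record DPermRaw (d n : ℕ) : Set where
  constructor mkDPerm
  field rows : Vec (Vec (Fin n) n) (d Data.Nat.∸ 1)
open DPermRaw public

IsDPerm : ∀ {d n} → DPermRaw d n → Set
IsDPerm {d} {n} π = ∀ (l : Fin (d Data.Nat.∸ 1)) (i j : Fin n) →
  lookup (lookup (rows π) l) i ≡ lookup (lookup (rows π) l) j → i ≡ j
  where import Data.Nat

-- points are indexed by their 0-th coordinate i ∈ Fin n;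
-- coord π l p is π_l(p), with π_0 = id
coord : ∀ {d n} → DPermRaw d n → Fin d → Fin n → Fin n
coord {suc d} π Fin.zero    p = p
coord {suc d} π (Fin.suc l) p = lookup (lookup (rows π) l) p

lastCoord : ∀ {d n} → DPermRaw d n → Fin n → Fin n
lastCoord {zero}  π p = p
lastCoord {suc d} π p = coord π (fromℕ d) p

-- dir(p,q) (meaningful for distinct points p ≠ q)
dir : ∀ {d n} → DPermRaw d n → Fin n → Fin n → Dir d
dir π p q = tabulate λ l →
  if toℕ (coord π l p) <ᵇ toℕ (coord π l q) then plus else minus

-- The max-tree γ^d(π), described on the original points (no relabelling).
-- A "region" is the point set of the sub-d-permutation at some node;
-- its node is the point of maximal last coordinate.

Region : ℕ → Set₁
Region n = Fin n → Set

IsRoot : ∀ {d n} → DPermRaw d n → Region n → Fin n → Set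
IsRoot π S r = S r × (∀ p → S p → toℕ (lastCoord π p) ≤ toℕ (lastCoord π r))

-- points of the subtree T_f(r) of the node r whose region is S
Child : ∀ {d n} → DPermRaw d n → Region n → Fin n → Dir d → Region n
Child π S r f p = S p × p ≢ r × dir π r p ≡ f

-- regions of (the sub-d-permutations at) the internal nodes and of all
-- subtrees of γ^d(π)
data Reach {d n} (π : DPermRaw d n) : Region n → Set₁ where
  top  : Reach π (λ _ → ⊤)
  step : ∀ {S} r (f : Dir d) → IsF f → Reach π S → IsRoot π S r →
         Reach π (Child π S r f)

Precedes : ∀ {d} → List (Dir d) → Dir d → Dir d → Set
Precedes C f₁ f₂ = ∃[ i ] ∃[ j ] (i <F j × L.lookup C i ≡ f₁ × L.lookup C j ≡ f₂)

CompatibleAxis : ∀ {d} → Fin d → List (Dir d) → Set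
CompatibleAxis k C = ∀ f₁ f₂ → Precedes C f₁ f₂ →
  lookup f₁ k ≡ plus → lookup f₂ k ≡ minus → ⊥

Compatible : ∀ {d} → Vec (List (Dir d)) d → Set
Compatible {d} C = ∀ (k : Fin d) → CompatibleAxis k (lookup C k)

Admissible : ∀ {d n} → List (Dir d) → Vec (List (Dir d)) d → DPermRaw d n → Set₁
Admissible {d} {n} F C π =
  (∀ S → Reach π S → ∀ r → IsRoot π S r →
     ∀ (l : Fin d) f₁ f₂ → f₁ ∈ F → f₂ ∈ F → Precedes (lookup C l) f₁ f₂ →
     ∀ p q → Child π S r f₁ p → Child π S r f₂ q →
     toℕ (coord π l p) Data.Nat.< toℕ (coord π l q))
  ×
  (∀ S → Reach π S → ∀ r → IsRoot π S r →
     ∀ (f : Dir d) → IsF f → ¬ (f ∈ F) → ∀ p → ¬ Child π S r f p)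
  where import Data.Nat

data KTree (k : ℕ) : Set where
  leaf : KTree k
  node : Vec (KTree k) k → KTree k

mutual
  internals : ∀ {k} → KTree k → ℕ
  internals leaf      = 0
  internals (node ts) = suc (internalsV ts)

  internalsV : ∀ {k m} → Vec (KTree k) m → ℕ
  internalsV []       = 0
  internalsV (t ∷ ts) = internals t + internalsV ts

KTreeN : ℕ → ℕ → Set
KTreeN k n = Σ (KTree k) (λ t → internals t ≡ n)

-- A k-ary tree t becomes a d-permutation by taking its internal nodes as points and giving
-- the node at address a the coordinate rank l t a on axis l: on every axis the nodes of a
-- subtree fill an interval, in which the subtrees of the children follow the order C_l and the
-- root sits right after the children whose direction is -1 on that axis. Compatibility of C_l
-- keeps this consistent, and as every direction of F ends in -1, the root of each subtree is
-- its point with the largest last coordinate. Hence the regions of the max-tree of the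
-- resulting d-permutation are exactly the subtrees of t, which gives admissibility and shows
-- that t is determined by its image. Conversely, for an admissible d-permutation, counting
-- inside each region of its max-tree the points below a given one satisfies the same recursive
-- rank formula; admissibility is exactly what makes these counts add up.

module Submission where

open import Defs
open import Data.Nat using (ℕ; _≤_)
open import Data.Fin using (Fin)
open import Data.Vec using (Vec; lookup)
open import Data.List using (List; length)
open import Data.List.Relation.Unary.All using (All)
open import Data.List.Relation.Unary.Unique.Propositional using (Unique)
open import Data.List.Relation.Binary.Permutation.Propositional using (_↭_)
open import Data.Product using (Σ-syntax; ∃-syntax; _×_)
open import Relation.Binary.PropositionalEquality using (_≡_)

open import Data.Bool using (if_then_else_)
open import Data.Empty using (⊥; ⊥-elim)
open import Data.Fin as Fin using (zero; suc; toℕ; fromℕ; fromℕ<; punchIn; punchOut; join; splitAt)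
import Data.Fin.Properties as Finₚ
open import Data.Fin.Properties
  using (any?; join-splitAt; toℕ-injective; toℕ-fromℕ<; toℕ<n; punchInᵢ≢i; punchOut-injective; injective⇒≤)
open import Data.List using ([]; _∷_; _++_; _∷ʳ_)
import Data.List as L
open import Data.List.Membership.Propositional using (_∈_)
open import Data.List.Membership.Propositional.Properties using (∈-lookup)
open import Data.List.Properties using (∷-injectiveˡ; ∷-injectiveʳ; ++-identityʳ; ++-identityʳ-unique; ∷ʳ-++)
open import Data.List.Relation.Binary.Permutation.Propositional using (↭-sym; ↭⇒↭ₛ)
open import Data.List.Relation.Binary.Permutation.Propositional.Properties using (∈-resp-↭)
open import Data.List.Relation.Binary.Permutation.Setoid.Properties using (Unique-resp-↭)
import Data.List.Relation.Unary.All as All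
open import Data.List.Relation.Unary.AllPairs using (_∷_)
open import Data.List.Relation.Unary.Any using (index)
open import Data.List.Relation.Unary.Any.Properties using (lookup-index)
open import Data.Nat using (zero; suc; _+_; _*_; _<_; _<ᵇ_; z≤n; s≤s; s≤s⁻¹; z<s)
open import Data.Nat.Properties
open import Algebra.Properties.CommutativeSemigroup +-commutativeSemigroup using (xy∙z≈xz∙y; x∙yz≈yx∙z)
open import Algebra.Properties.Semiring.Sum +-*-semiring
  using (sum; sum-cong-≗; sum-replicate-zero; sum-remove; ∑-distrib-+; ∑-comm; *-distribˡ-sum; *-distribʳ-sum)
open import Data.Product using (∃; ∃₂; _,_; proj₁; proj₂; map₁; map₂)
open import Data.Sum using (_⊎_; inj₁; inj₂)
open import Data.Unit using (⊤; tt)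
open import Data.Vec using ([]; _∷_; tabulate)
open import Data.Vec.Properties using (lookup∘tabulate; ≡-dec)
open import Data.Vec.Relation.Binary.Pointwise.Extensional using (ext; Pointwise-≡⇒≡)
open import Function using (_∘_; const; Injective)
open import Function.Bundles using (_⇔_; mk⇔; Equivalence)
open import Level using (0ℓ)
open import Relation.Binary using (tri<; tri≈; tri>; DecidableEquality)
open import Relation.Binary.PropositionalEquality
  using (_≢_; refl; sym; trans; cong; cong₂; subst; subst₂; setoid; module ≡-Reasoning)
open import Relation.Nullary using (Dec; yes; no; ¬_; ¬?; _×-dec_; contradiction; Reflects; ofʸ; ofⁿ)
open import Relation.Unary using (Pred; Decidable; U; Empty; _⊆_; _≐_)
open import Relation.Unary.Properties using (≐-refl; ≐-sym; ≐-trans)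

private
  variable
    m : ℕ
    P Q : Set

⟦_⟧ : Dec P → ℕ
⟦ yes _ ⟧ = 1
⟦ no _ ⟧ = 0

⟦⟧-yes : (P? : Dec P) → P → ⟦ P? ⟧ ≡ 1
⟦⟧-yes (yes _) _ = refl
⟦⟧-yes (no ¬p) p = contradiction p ¬p

⟦⟧-no : (P? : Dec P) → ¬ P → ⟦ P? ⟧ ≡ 0
⟦⟧-no (yes p) ¬p = contradiction p ¬p
⟦⟧-no (no _) _ = refl

⟦⟧≤1 : (P? : Dec P) → ⟦ P? ⟧ ≤ 1
⟦⟧≤1 (yes _) = ≤-refl
⟦⟧≤1 (no _) = z≤n

⟦⟧-mono : (P? : Dec P) (Q? : Dec Q) → (P → Q) → ⟦ P? ⟧ ≤ ⟦ Q? ⟧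
⟦⟧-mono (yes p) Q? P⇒Q = ≤-reflexive (sym (⟦⟧-yes Q? (P⇒Q p)))
⟦⟧-mono (no _) Q? P⇒Q = z≤n

⟦⟧-cong : (P? : Dec P) (Q? : Dec Q) → (P → Q) → (Q → P) → ⟦ P? ⟧ ≡ ⟦ Q? ⟧
⟦⟧-cong P? Q? P⇒Q Q⇒P = ≤-antisym (⟦⟧-mono P? Q? P⇒Q) (⟦⟧-mono Q? P? Q⇒P)

sum-mono-≤ : {f g : Fin m → ℕ} → (∀ i → f i ≤ g i) → sum f ≤ sum g
sum-mono-≤ {zero} f≤g = z≤n
sum-mono-≤ {suc m} f≤g = +-mono-≤ (f≤g zero) (sum-mono-≤ (f≤g ∘ suc))

sum-zero : {f : Fin m → ℕ} → (∀ i → f i ≡ 0) → sum f ≡ 0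
sum-zero {m} f≡0 = trans (sum-cong-≗ f≡0) (sum-replicate-zero m)

≤-sum : (f : Fin m → ℕ) (i : Fin m) → f i ≤ sum f
≤-sum {suc m} f i = ≤-trans (m≤m+n (f i) _) (≤-reflexive (sym (sum-remove f)))

sum-single : (f : Fin m → ℕ) (j : Fin m) → (∀ i → i ≢ j → f i ≡ 0) → sum f ≡ f j
sum-single {suc m} f j others = begin
  sum f                                    ≡⟨ sum-remove f ⟩
  f j + sum (λ i → f (punchIn j i))        ≡⟨ cong (f j +_) (sum-zero λ i → others _ (punchInᵢ≢i j i)) ⟩
  f j + 0                                  ≡⟨ +-identityʳ (f j) ⟩
  f j                                      ∎
  where open ≡-Reasoning

sumWhere : {P : Pred (Fin m) 0ℓ} → Decidable P → (Fin m → ℕ) → ℕ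
sumWhere P? w = sum λ i → ⟦ P? i ⟧ * w i

count : {P : Pred (Fin m) 0ℓ} → Decidable P → ℕ
count P? = sumWhere P? λ _ → 1

module _ {P : Pred (Fin m) 0ℓ} (P? : Decidable P) where

  sumWhere-cong : {w w′ : Fin m → ℕ} → (∀ i → w i ≡ w′ i) → sumWhere P? w ≡ sumWhere P? w′
  sumWhere-cong w≡w′ = sum-cong-≗ λ i → cong (⟦ P? i ⟧ *_) (w≡w′ i)

  sumWhere≤sum : (w : Fin m → ℕ) → sumWhere P? w ≤ sum w
  sumWhere≤sum w = sum-mono-≤ λ i → ≤-trans (*-monoˡ-≤ (w i) (⟦⟧≤1 (P? i))) (≤-reflexive (*-identityˡ (w i)))

  sumWhere-mono : {Q : Pred (Fin m) 0ℓ} (Q? : Decidable Q) (w : Fin m → ℕ) →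
    (∀ {i} → P i → Q i) → sumWhere P? w ≤ sumWhere Q? w
  sumWhere-mono Q? w P⊆Q = sum-mono-≤ λ i → *-monoˡ-≤ (w i) (⟦⟧-mono (P? i) (Q? i) P⊆Q)

  sumWhere-const : {w : Fin m → ℕ} (c : ℕ) → (∀ {i} → P i → w i ≡ c) → sumWhere P? w ≡ c * count P?
  sumWhere-const {w} c w≡c = begin
    sum (λ i → ⟦ P? i ⟧ * w i)         ≡⟨ sum-cong-≗ pointwise ⟩
    sum (λ i → c * (⟦ P? i ⟧ * 1))     ≡⟨ *-distribˡ-sum {m} c _ ⟨
    c * count P?                       ∎
    where
    open ≡-Reasoning
    pointwise : ∀ i → ⟦ P? i ⟧ * w i ≡ c * (⟦ P? i ⟧ * 1)
    pointwise i with P? i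
    ... | yes p = trans (+-identityʳ (w i)) (trans (w≡c p) (sym (*-identityʳ c)))
    ... | no _ = sym (*-zeroʳ c)

U? : Decidable {A = Fin m} U
U? _ = yes tt

sumWhere-≟ : (w : Fin m → ℕ) (j : Fin m) → sumWhere (Fin._≟ j) w ≡ w j
sumWhere-≟ w j = begin
  sumWhere (Fin._≟ j) w   ≡⟨ sum-single _ j (λ i i≢j → cong (_* w i) (⟦⟧-no (i Fin.≟ j) i≢j)) ⟩
  ⟦ j Fin.≟ j ⟧ * w j     ≡⟨ cong (_* w j) (⟦⟧-yes (j Fin.≟ j) refl) ⟩
  1 * w j                 ≡⟨ *-identityˡ (w j) ⟩
  w j                     ∎
  where open ≡-Reasoning

sumWhere-insert : {P Q : Pred (Fin m) 0ℓ} (P? : Decidable P) (Q? : Decidable Q) (w : Fin m → ℕ) {j : Fin m} →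
  (∀ {i} → P i → Q i) → ¬ P j → Q j → sumWhere P? w + w j ≤ sumWhere Q? w
sumWhere-insert {P = P} {Q} P? Q? w {j} P⊆Q ¬Pj Qj = begin
  sumWhere P? w + w j                                   ≡⟨ cong (sumWhere P? w +_) (sumWhere-≟ w j) ⟨
  sumWhere P? w + sumWhere (Fin._≟ j) w                 ≡⟨ ∑-distrib-+ (λ i → ⟦ P? i ⟧ * w i) _ ⟨
  sum (λ i → ⟦ P? i ⟧ * w i + ⟦ i Fin.≟ j ⟧ * w i)     ≤⟨ sum-mono-≤ pointwise ⟩
  sumWhere Q? w                                         ∎
  where
  open ≤-Reasoning
  brackets : ∀ i → ⟦ P? i ⟧ + ⟦ i Fin.≟ j ⟧ ≤ ⟦ Q? i ⟧
  brackets i with i Fin.≟ j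
  ... | yes refl = ≤-reflexive (trans (cong (_+ 1) (⟦⟧-no (P? i) ¬Pj)) (sym (⟦⟧-yes (Q? i) Qj)))
  ... | no _ = ≤-trans (≤-reflexive (+-identityʳ _)) (⟦⟧-mono (P? i) (Q? i) P⊆Q)
  pointwise : ∀ i → ⟦ P? i ⟧ * w i + ⟦ i Fin.≟ j ⟧ * w i ≤ ⟦ Q? i ⟧ * w i
  pointwise i = ≤-trans (≤-reflexive (sym (*-distribʳ-+ (w i) ⟦ P? i ⟧ _))) (*-monoˡ-≤ (w i) (brackets i))

count-U : count {m} U? ≡ m
count-U {zero}  = refl
count-U {suc m} = cong suc (count-U {m})

count-positive : {P : Pred (Fin m) 0ℓ} (P? : Decidable P) → ∀ {i} → P i → 0 < count P?
count-positive P? {i} Pi =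
  ≤-trans (≤-reflexive (sym (cong (_* 1) (⟦⟧-yes (P? i) Pi)))) (≤-sum (λ j → ⟦ P? j ⟧ * 1) i)

maximum-or-empty : {P : Pred (Fin m) 0ℓ} → Decidable P → (v : Fin m → ℕ) →
  (∃ λ r → P r × (∀ p → P p → v p ≤ v r)) ⊎ Empty P
maximum-or-empty {zero}  P? v = inj₂ λ ()
maximum-or-empty {suc m} P? v with maximum-or-empty (P? ∘ suc) (v ∘ suc) | P? zero
... | inj₂ none | no ¬P0 = inj₂ λ { zero → ¬P0 ; (suc p) → none p }
... | inj₂ none | yes P0 = inj₁ (zero , P0 , λ { zero _ → ≤-refl ; (suc p) Pp → contradiction Pp (none p) })
... | inj₁ (r , Pr , r-max) | no ¬P0 =
  inj₁ (suc r , Pr , λ { zero P0 → contradiction P0 ¬P0 ; (suc p) Pp → r-max p Pp })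
... | inj₁ (r , Pr , r-max) | yes P0 with ≤-total (v zero) (v (suc r))
...   | inj₁ v0≤vr = inj₁ (suc r , Pr , λ { zero _ → v0≤vr ; (suc p) Pp → r-max p Pp })
...   | inj₂ vr≤v0 = inj₁ (zero , P0 , λ { zero _ → ≤-refl ; (suc p) Pp → ≤-trans (r-max p Pp) vr≤v0 })

injective⇒surjective : (f : Fin m → Fin m) → Injective _≡_ _≡_ f → ∀ y → ∃ λ x → f x ≡ y
injective⇒surjective {suc m} f f-inj y with any? (λ x → f x Fin.≟ y)
... | yes hit = hit
... | no miss = contradiction (injective⇒≤ g-inj) 1+n≰n
  where
  y≢f : ∀ x → y ≢ f x
  y≢f x y≡fx = miss (x , sym y≡fx)
  g : Fin (suc m) → Fin m
  g x = punchOut (y≢f x)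
  g-inj : Injective _≡_ _≡_ g
  g-inj {x} {x′} e = f-inj (punchOut-injective (y≢f x) (y≢f x′) e)

⟦<?suc⟧ : ∀ x v → ⟦ x <? suc v ⟧ ≡ ⟦ x <? v ⟧ + ⟦ x ≟ v ⟧
⟦<?suc⟧ x v with <-cmp x v
... | tri< x<v x≢v _ = trans (⟦⟧-yes (x <? suc v) (m<n⇒m<1+n x<v))
                             (sym (cong₂ _+_ (⟦⟧-yes (x <? v) x<v) (⟦⟧-no (x ≟ v) x≢v)))
... | tri≈ x≮v x≡v _ = trans (⟦⟧-yes (x <? suc v) (s≤s (≤-reflexive x≡v)))
                             (sym (cong₂ _+_ (⟦⟧-no (x <? v) x≮v) (⟦⟧-yes (x ≟ v) x≡v)))
... | tri> x≮v x≢v v<x = trans (⟦⟧-no (x <? suc v) (<⇒≱ v<x ∘ s≤s⁻¹))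
                               (sym (cong₂ _+_ (⟦⟧-no (x <? v) x≮v) (⟦⟧-no (x ≟ v) x≢v)))

count-below-injective : (c : Fin m → Fin m) → Injective _≡_ _≡_ c →
  ∀ v → v ≤ m → sum (λ q → ⟦ toℕ (c q) <? v ⟧) ≡ v
count-below-injective c c-inj zero _ = sum-zero λ q → ⟦⟧-no (toℕ (c q) <? 0) λ ()
count-below-injective c c-inj (suc v) v<m = begin
  sum (λ q → ⟦ toℕ (c q) <? suc v ⟧)
    ≡⟨ sum-cong-≗ (λ q → ⟦<?suc⟧ (toℕ (c q)) v) ⟩
  sum (λ q → ⟦ toℕ (c q) <? v ⟧ + ⟦ toℕ (c q) ≟ v ⟧)
    ≡⟨ ∑-distrib-+ (λ q → ⟦ toℕ (c q) <? v ⟧) _ ⟩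
  sum (λ q → ⟦ toℕ (c q) <? v ⟧) + sum (λ q → ⟦ toℕ (c q) ≟ v ⟧)
    ≡⟨ cong₂ _+_ (count-below-injective c c-inj v (<⇒≤ v<m)) hit-once ⟩
  v + 1
    ≡⟨ +-comm v 1 ⟩
  suc v ∎
  where
  open ≡-Reasoning
  q₀ = proj₁ (injective⇒surjective c c-inj (fromℕ< v<m))
  cq₀≡v : toℕ (c q₀) ≡ v
  cq₀≡v = trans (cong toℕ (proj₂ (injective⇒surjective c c-inj (fromℕ< v<m)))) (toℕ-fromℕ< v<m)
  hit-once : sum (λ q → ⟦ toℕ (c q) ≟ v ⟧) ≡ 1
  hit-once = trans (sum-single _ q₀ λ q q≢q₀ → ⟦⟧-no (toℕ (c q) ≟ v) λ cq≡v →
                     q≢q₀ (c-inj (toℕ-injective (trans cq≡v (sym cq₀≡v)))))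
                   (⟦⟧-yes (toℕ (c q₀) ≟ v) cq₀≡v)

Unique-lookup-injective : {A : Set} {xs : List A} → Unique xs → Injective _≡_ _≡_ (L.lookup xs)
Unique-lookup-injective (_ ∷ _) {zero} {zero} _ = refl
Unique-lookup-injective (x∉ ∷ _) {zero} {suc j} e = contradiction e (All.lookup x∉ (∈-lookup j))
Unique-lookup-injective (x∉ ∷ _) {suc i} {zero} e = contradiction (sym e) (All.lookup x∉ (∈-lookup i))
Unique-lookup-injective (_ ∷ xs-unique) {suc i} {suc j} e = cong suc (Unique-lookup-injective xs-unique e)

module _ {k : ℕ} where

  Internal : KTree k → List (Fin k) → Set
  Internal leaf      _       = ⊥
  Internal (node ts) []      = ⊤
  Internal (node ts) (j ∷ a) = Internal (lookup ts j) a

  Internal-prefix : ∀ t a {b} → Internal t (a ++ b) → Internal t a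
  Internal-prefix (node ts) []      _  = tt
  Internal-prefix (node ts) (j ∷ a) ia = Internal-prefix (lookup ts j) a ia

  mutual
    Internal-ext : ∀ t u → (∀ a → Internal t a → Internal u a) → (∀ a → Internal u a → Internal t a) → t ≡ u
    Internal-ext leaf      leaf      _   _   = refl
    Internal-ext leaf      (node us) _   u⊆t = ⊥-elim (u⊆t [] tt)
    Internal-ext (node ts) leaf      t⊆u _   = ⊥-elim (t⊆u [] tt)
    Internal-ext (node ts) (node us) t⊆u u⊆t =
      cong node (Internal-extᵛ ts us (λ j a → t⊆u (j ∷ a)) (λ j a → u⊆t (j ∷ a)))

    Internal-extᵛ : ∀ {m} (ts us : Vec (KTree k) m) →
      (∀ j a → Internal (lookup ts j) a → Internal (lookup us j) a) →
      (∀ j a → Internal (lookup us j) a → Internal (lookup ts j) a) → ts ≡ us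
    Internal-extᵛ []       []       _   _   = refl
    Internal-extᵛ (t ∷ ts) (u ∷ us) t⊆u u⊆t =
      cong₂ _∷_ (Internal-ext t u (t⊆u zero) (u⊆t zero)) (Internal-extᵛ ts us (t⊆u ∘ suc) (u⊆t ∘ suc))

  internalsV≡sum : ∀ {m} (ts : Vec (KTree k) m) → internalsV ts ≡ sum (λ i → internals (lookup ts i))
  internalsV≡sum []       = refl
  internalsV≡sum (t ∷ ts) = cong (internals t +_) (internalsV≡sum ts)

  KTreeN-≡ : ∀ {n} {t u : KTreeN k n} → proj₁ t ≡ proj₁ u → t ≡ u
  KTreeN-≡ {t = t , e} {.t , e′} refl = cong (t ,_) (≡-irrelevant e e′)

  mutual
    enumerate : (t : KTree k) → Fin (internals t) → List (Fin k)
    enumerate (node ts) zero    = []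
    enumerate (node ts) (suc i) = proj₁ (enumerateᵛ ts i) ∷ proj₂ (enumerateᵛ ts i)

    enumerateᵛ : ∀ {m} (ts : Vec (KTree k) m) → Fin (internalsV ts) → Fin m × List (Fin k)
    enumerateᵛ (t ∷ ts) i = enumerate-⊎ t ts (splitAt (internals t) i)

    enumerate-⊎ : ∀ {m} t (ts : Vec (KTree k) m) → Fin (internals t) ⊎ Fin (internalsV ts) → Fin (suc m) × List (Fin k)
    enumerate-⊎ t ts (inj₁ x) = zero , enumerate t x
    enumerate-⊎ t ts (inj₂ y) = map₁ suc (enumerateᵛ ts y)

  mutual
    enumerate-internal : ∀ t i → Internal t (enumerate t i)
    enumerate-internal (node ts) zero    = tt
    enumerate-internal (node ts) (suc i) = enumerateᵛ-internal ts i

    enumerateᵛ-internal : ∀ {m} (ts : Vec (KTree k) m) i →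
      Internal (lookup ts (proj₁ (enumerateᵛ ts i))) (proj₂ (enumerateᵛ ts i))
    enumerateᵛ-internal (t ∷ ts) i = enumerate-⊎-internal t ts (splitAt (internals t) i)

    enumerate-⊎-internal : ∀ {m} t (ts : Vec (KTree k) m) x →
      Internal (lookup (t ∷ ts) (proj₁ (enumerate-⊎ t ts x))) (proj₂ (enumerate-⊎ t ts x))
    enumerate-⊎-internal t ts (inj₁ x) = enumerate-internal t x
    enumerate-⊎-internal t ts (inj₂ y) = enumerateᵛ-internal ts y

  mutual
    enumerate-injective : ∀ t → Injective _≡_ _≡_ (enumerate t)
    enumerate-injective (node ts) {zero}  {zero}   _ = refl
    enumerate-injective (node ts) {suc i} {suc i′} e =
      cong suc (enumerateᵛ-injective ts (cong₂ _,_ (∷-injectiveˡ e) (∷-injectiveʳ e)))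

    enumerateᵛ-injective : ∀ {m} (ts : Vec (KTree k) m) → Injective _≡_ _≡_ (enumerateᵛ ts)
    enumerateᵛ-injective (t ∷ ts) {i} {i′} e = begin
      i                                          ≡⟨ join-splitAt (internals t) _ i ⟨
      join _ _ (splitAt (internals t) i)         ≡⟨ cong (join _ _) (enumerate-⊎-injective t ts e) ⟩
      join _ _ (splitAt (internals t) i′)        ≡⟨ join-splitAt (internals t) _ i′ ⟩
      i′                                         ∎
      where open ≡-Reasoning

    enumerate-⊎-injective : ∀ {m} t (ts : Vec (KTree k) m) → Injective _≡_ _≡_ (enumerate-⊎ t ts)
    enumerate-⊎-injective t ts {inj₁ x} {inj₁ x′} e = cong inj₁ (enumerate-injective t (cong proj₂ e))
    enumerate-⊎-injective t ts {inj₁ x} {inj₂ y′} e = contradiction (cong proj₁ e) Finₚ.0≢1+n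
    enumerate-⊎-injective t ts {inj₂ y} {inj₁ x′} e = contradiction (sym (cong proj₁ e)) Finₚ.0≢1+n
    enumerate-⊎-injective t ts {inj₂ y} {inj₂ y′} e =
      cong inj₂ (enumerateᵛ-injective ts (cong₂ _,_ (Finₚ.suc-injective (cong proj₁ e)) (cong proj₂ e)))

_≟ₛ_ : DecidableEquality Sign
plus  ≟ₛ plus  = yes refl
plus  ≟ₛ minus = no λ ()
minus ≟ₛ plus  = no λ ()
minus ≟ₛ minus = yes refl

plus≢minus : plus ≢ minus
plus≢minus ()

module Ranking {k d : ℕ} (label : Fin k → Dir d) (pos : Fin d → Fin k → ℕ)
  (pos-injective : ∀ l → Injective _≡_ _≡_ (pos l))
  (compatible : ∀ l {i j} → pos l i < pos l j → lookup (label i) l ≡ plus → lookup (label j) l ≡ plus)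
  where

  sign : Fin k → Fin d → Sign
  sign j l = lookup (label j) l

  _≺⟨_⟩_ : Fin k → Fin d → Fin k → Set
  i ≺⟨ l ⟩ j = pos l i < pos l j

  ≺-total : ∀ l {i j} → i ≢ j → i ≺⟨ l ⟩ j ⊎ j ≺⟨ l ⟩ i
  ≺-total l {i} {j} i≢j with <-cmp (pos l i) (pos l j)
  ... | tri< i≺j _ _ = inj₁ i≺j
  ... | tri≈ _ i≈j _ = contradiction (pos-injective l i≈j) i≢j
  ... | tri> _ _ j≺i = inj₂ j≺i

  ≺-minus : ∀ l {i j} → i ≺⟨ l ⟩ j → sign j l ≡ minus → sign i l ≡ minus
  ≺-minus l {i} i≺j j-minus with sign i l in i-sign
  ... | minus = refl
  ... | plus  = contradiction (trans (sym (compatible l i≺j i-sign)) j-minus) λ ()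

  size : Vec (KTree k) k → Fin k → ℕ
  size ts j = internals (lookup ts j)

  rootRank : Fin d → (Fin k → ℕ) → ℕ
  rootRank l sizes = sumWhere (λ i → sign i l ≟ₛ minus) sizes

  preceding : Fin d → (Fin k → ℕ) → Fin k → ℕ
  preceding l sizes j = sumWhere (λ i → pos l i <? pos l j) sizes

  -- The l-th coordinate (from 0) of the point at node a of t: along axis l the root comes
  -- right after the subtrees of the children labelled -1 on axis l, and the subtrees of the
  -- children are stacked in the order ≺⟨ l ⟩.
  rank : Fin d → KTree k → List (Fin k) → ℕ
  rank l leaf      _       = 0
  rank l (node ts) []      = rootRank l (size ts)
  rank l (node ts) (j ∷ a) = preceding l (size ts) j + ⟦ sign j l ≟ₛ plus ⟧ + rank l (lookup ts j) a

  rank<internals : ∀ l t a → Internal t a → rank l t a < internals t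
  rank<internals l (node ts) [] _ =
    s≤s (≤-trans (sumWhere≤sum (λ i → sign i l ≟ₛ minus) (size ts)) (≤-reflexive (sym (internalsV≡sum ts))))
  rank<internals l (node ts) (j ∷ a) ia = s≤s (begin
    preceding l (size ts) j + ⟦ sign j l ≟ₛ plus ⟧ + rank l (lookup ts j) a
      ≡⟨ +-assoc (preceding l (size ts) j) _ _ ⟩
    preceding l (size ts) j + (⟦ sign j l ≟ₛ plus ⟧ + rank l (lookup ts j) a)
      ≤⟨ +-monoʳ-≤ (preceding l (size ts) j) (+-monoˡ-≤ _ (⟦⟧≤1 (sign j l ≟ₛ plus))) ⟩
    preceding l (size ts) j + suc (rank l (lookup ts j) a)
      ≤⟨ +-monoʳ-≤ (preceding l (size ts) j) (rank<internals l (lookup ts j) a ia) ⟩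
    preceding l (size ts) j + size ts j
      ≤⟨ sumWhere-insert (λ i → pos l i <? pos l j) U? (size ts) _ (<-irrefl refl) tt ⟩
    sumWhere U? (size ts)
      ≤⟨ sumWhere≤sum U? (size ts) ⟩
    sum (size ts)
      ≡⟨ internalsV≡sum ts ⟨
    internalsV ts ∎)
    where open ≤-Reasoning

  minus-child<root : ∀ l t {j w} → Internal t (j ∷ w) → sign j l ≡ minus → rank l t (j ∷ w) < rank l t []
  minus-child<root l (node ts) {j} {w} iw j-minus = begin-strict
    preceding l (size ts) j + ⟦ sign j l ≟ₛ plus ⟧ + rank l (lookup ts j) w
      ≡⟨ cong (λ b → preceding l (size ts) j + b + rank l (lookup ts j) w)
              (⟦⟧-no (sign j l ≟ₛ plus) j-not-plus) ⟩
    preceding l (size ts) j + 0 + rank l (lookup ts j) w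
      ≡⟨ cong (_+ rank l (lookup ts j) w) (+-identityʳ _) ⟩
    preceding l (size ts) j + rank l (lookup ts j) w
      <⟨ +-monoʳ-< (preceding l (size ts) j) (rank<internals l (lookup ts j) w iw) ⟩
    preceding l (size ts) j + size ts j
      ≤⟨ sumWhere-insert (λ i → pos l i <? pos l j) (λ i → sign i l ≟ₛ minus) (size ts)
                         (λ i≺j → ≺-minus l i≺j j-minus) (<-irrefl refl) j-minus ⟩
    rootRank l (size ts) ∎
    where
    open ≤-Reasoning
    j-not-plus : sign j l ≢ plus
    j-not-plus j-plus = plus≢minus (trans (sym j-plus) j-minus)

  root<plus-child : ∀ l t {j w} → Internal t (j ∷ w) → sign j l ≡ plus → rank l t [] < rank l t (j ∷ w)
  root<plus-child l (node ts) {j} {w} _ j-plus = begin-strict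
    rootRank l (size ts)
      ≤⟨ sumWhere-mono (λ i → sign i l ≟ₛ minus) (λ i → pos l i <? pos l j) (size ts) minus⇒≺ ⟩
    preceding l (size ts) j
      <⟨ m<m+n (preceding l (size ts) j) z<s ⟩
    preceding l (size ts) j + 1
      ≡⟨ cong (preceding l (size ts) j +_) (⟦⟧-yes (sign j l ≟ₛ plus) j-plus) ⟨
    preceding l (size ts) j + ⟦ sign j l ≟ₛ plus ⟧
      ≤⟨ m≤m+n _ _ ⟩
    preceding l (size ts) j + ⟦ sign j l ≟ₛ plus ⟧ + rank l (lookup ts j) w ∎
    where
    open ≤-Reasoning
    minus⇒≺ : ∀ {i} → sign i l ≡ minus → i ≺⟨ l ⟩ j
    minus⇒≺ {i} i-minus with ≺-total l {i} {j} (λ { refl → plus≢minus (trans (sym j-plus) i-minus) })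
    ... | inj₁ i≺j = i≺j
    ... | inj₂ j≺i = contradiction (trans (sym (compatible l j≺i j-plus)) i-minus) plus≢minus

  ordered-children< : ∀ l t {i j w w′} → Internal t (i ∷ w) → Internal t (j ∷ w′) → i ≺⟨ l ⟩ j →
    rank l t (i ∷ w) < rank l t (j ∷ w′)
  ordered-children< l (node ts) {i} {j} {w} {w′} iw _ i≺j = begin-strict
    preceding l (size ts) i + ⟦ sign i l ≟ₛ plus ⟧ + rank l (lookup ts i) w
      <⟨ +-monoʳ-< (preceding l (size ts) i + _) (rank<internals l (lookup ts i) w iw) ⟩
    preceding l (size ts) i + ⟦ sign i l ≟ₛ plus ⟧ + size ts i
      ≡⟨ xy∙z≈xz∙y (preceding l (size ts) i) _ _ ⟩
    preceding l (size ts) i + size ts i + ⟦ sign i l ≟ₛ plus ⟧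
      ≤⟨ +-mono-≤ (sumWhere-insert (λ x → pos l x <? pos l i) (λ x → pos l x <? pos l j) (size ts)
                                   (λ x≺i → <-trans x≺i i≺j) (<-irrefl refl) i≺j)
                  (⟦⟧-mono (sign i l ≟ₛ plus) (sign j l ≟ₛ plus) (compatible l i≺j)) ⟩
    preceding l (size ts) j + ⟦ sign j l ≟ₛ plus ⟧
      ≤⟨ m≤m+n _ _ ⟩
    preceding l (size ts) j + ⟦ sign j l ≟ₛ plus ⟧ + rank l (lookup ts j) w′ ∎
    where open ≤-Reasoning

  root≢child : ∀ l t {j w} → Internal t (j ∷ w) → rank l t [] ≢ rank l t (j ∷ w)
  root≢child l t {j} iw with sign j l in j-sign
  ... | plus  = <⇒≢ (root<plus-child l t iw j-sign)
  ... | minus = >⇒≢ (minus-child<root l t iw j-sign)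

  rank-injective : ∀ l t {a b} → Internal t a → Internal t b → rank l t a ≡ rank l t b → a ≡ b
  rank-injective l (node ts) {[]}    {[]}    _  _  _ = refl
  rank-injective l t         {[]}    {j ∷ b} _  ib e = contradiction e (root≢child l t ib)
  rank-injective l t         {i ∷ a} {[]}    ia _  e = contradiction (sym e) (root≢child l t ia)
  rank-injective l (node ts) {i ∷ a} {j ∷ b} ia ib e with i Fin.≟ j
  ... | yes refl = cong (i ∷_) (rank-injective l (lookup ts i) ia ib (+-cancelˡ-≡ _ _ _ e))
  ... | no i≢j with ≺-total l i≢j
  ...   | inj₁ i≺j = contradiction e (<⇒≢ (ordered-children< l (node ts) ia ib i≺j))
  ...   | inj₂ j≺i = contradiction e (>⇒≢ (ordered-children< l (node ts) ib ia j≺i))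

  descendant<ancestor : ∀ l t a {j w} → Internal t (a ++ j ∷ w) → sign j l ≡ minus →
    rank l t (a ++ j ∷ w) < rank l t a
  descendant<ancestor l t         []      iw j-minus = minus-child<root l t iw j-minus
  descendant<ancestor l (node ts) (i ∷ a) iw j-minus = +-monoʳ-< _ (descendant<ancestor l (lookup ts i) a iw j-minus)

  ancestor<descendant : ∀ l t a {j w} → Internal t (a ++ j ∷ w) → sign j l ≡ plus →
    rank l t a < rank l t (a ++ j ∷ w)
  ancestor<descendant l t         []      iw j-plus = root<plus-child l t iw j-plus
  ancestor<descendant l (node ts) (i ∷ a) iw j-plus = +-monoʳ-< _ (ancestor<descendant l (lookup ts i) a iw j-plus)

  ordered-descendants< : ∀ l t a {i j w w′} → Internal t (a ++ i ∷ w) → Internal t (a ++ j ∷ w′) →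
    i ≺⟨ l ⟩ j → rank l t (a ++ i ∷ w) < rank l t (a ++ j ∷ w′)
  ordered-descendants< l t         []      iw iw′ i≺j = ordered-children< l t iw iw′ i≺j
  ordered-descendants< l (node ts) (x ∷ a) iw iw′ i≺j = +-monoʳ-< _ (ordered-descendants< l (lookup ts x) a iw iw′ i≺j)

if≡plus⇔ : ∀ {b} → Reflects P b → (if b then plus else minus) ≡ plus ⇔ P
if≡plus⇔ (ofʸ p)  = mk⇔ (const p) (const refl)
if≡plus⇔ (ofⁿ ¬p) = mk⇔ (λ ()) (λ p → contradiction p ¬p)

if≡minus⇔ : ∀ {b} → Reflects P b → (if b then plus else minus) ≡ minus ⇔ (¬ P)
if≡minus⇔ (ofʸ p)  = mk⇔ (λ ()) (λ ¬p → contradiction p ¬p)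
if≡minus⇔ (ofⁿ ¬p) = mk⇔ (const ¬p) (const refl)

module _ {d n : ℕ} (π : DPermRaw d n) where

  private
    c : Fin d → Fin n → ℕ
    c l p = toℕ (coord π l p)

  lookup-dir : ∀ p q l → lookup (dir π p q) l ≡ (if c l p <ᵇ c l q then plus else minus)
  lookup-dir p q l = lookup∘tabulate _ l

  dir≡plus⇔ : ∀ p q l → lookup (dir π p q) l ≡ plus ⇔ c l p < c l q
  dir≡plus⇔ p q l = subst (λ s → s ≡ plus ⇔ c l p < c l q) (sym (lookup-dir p q l))
    (if≡plus⇔ (<ᵇ-reflects-< (c l p) (c l q)))

  dir≡minus⇔ : ∀ p q l → lookup (dir π p q) l ≡ minus ⇔ (¬ c l p < c l q)
  dir≡minus⇔ p q l = subst (λ s → s ≡ minus ⇔ (¬ c l p < c l q)) (sym (lookup-dir p q l))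
    (if≡minus⇔ (<ᵇ-reflects-< (c l p) (c l q)))

  IsRoot-resp-≐ : ∀ {S T r} → S ≐ T → IsRoot π S r → IsRoot π T r
  IsRoot-resp-≐ {r = r} (S⊆T , T⊆S) (Sr , r-max) = S⊆T {r} Sr , λ p Tp → r-max p (T⊆S {p} Tp)

  IsRoot-lastCoord : ∀ {S r r′} → IsRoot π S r → IsRoot π S r′ → lastCoord π r ≡ lastCoord π r′
  IsRoot-lastCoord (Sr , r-max) (Sr′ , r′-max) = toℕ-injective (≤-antisym (r′-max _ Sr) (r-max _ Sr′))

  Child-resp-≐ : ∀ {S T r f} → S ≐ T → Child π S r f ≐ Child π T r f
  Child-resp-≐ (S⊆T , T⊆S) = (λ (Sp , rest) → S⊆T Sp , rest) , (λ (Tp , rest) → T⊆S Tp , rest)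

module Bijection {d : ℕ} (F : List (Dir (suc d))) (F-unique : Unique F) (F-directions : All IsF F)
  (C : Vec (List (Dir (suc d))) (suc d)) (C↭F : ∀ l → lookup C l ↭ F) (C-compatible : Compatible C)
  where

  k : ℕ
  k = length F

  label : Fin k → Dir (suc d)
  label = L.lookup F

  label-injective : Injective _≡_ _≡_ label
  label-injective = Unique-lookup-injective F-unique

  label-IsF : ∀ j → IsF (label j)
  label-IsF j = All.lookup F-directions (∈-lookup j)

  label? : ∀ f → Dec (∃ λ j → label j ≡ f)
  label? f = any? λ j → ≡-dec _≟ₛ_ (label j) f

  ∈⇒label : ∀ {f} → f ∈ F → ∃ λ j → label j ≡ f
  ∈⇒label f∈F = index f∈F , sym (lookup-index f∈F)

  label∈C : ∀ l j → label j ∈ lookup C l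
  label∈C l j = ∈-resp-↭ (↭-sym (C↭F l)) (∈-lookup j)

  position : ∀ l → Fin k → Fin (length (lookup C l))
  position l j = index (label∈C l j)

  pos : Fin (suc d) → Fin k → ℕ
  pos l j = toℕ (position l j)

  lookup-position : ∀ l j → L.lookup (lookup C l) (position l j) ≡ label j
  lookup-position l j = sym (lookup-index (label∈C l j))

  position-unique : ∀ l {j} x → L.lookup (lookup C l) x ≡ label j → x ≡ position l j
  position-unique l x x↦j =
    Unique-lookup-injective (Unique-resp-↭ (setoid _) (↭⇒↭ₛ (↭-sym (C↭F l))) F-unique)
      (trans x↦j (sym (lookup-position l _)))

  pos-injective : ∀ l → Injective _≡_ _≡_ (pos l)
  pos-injective l {i} {j} e = label-injective (begin
    label i                                  ≡⟨ lookup-position l i ⟨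
    L.lookup (lookup C l) (position l i)     ≡⟨ cong (L.lookup (lookup C l)) (toℕ-injective e) ⟩
    L.lookup (lookup C l) (position l j)     ≡⟨ lookup-position l j ⟩
    label j                                  ∎)
    where open ≡-Reasoning

  Precedes⇔< : ∀ l {i j} → Precedes (lookup C l) (label i) (label j) ⇔ pos l i < pos l j
  Precedes⇔< l {i} {j} = mk⇔ to-< from-<
    where
    to-< : Precedes (lookup C l) (label i) (label j) → pos l i < pos l j
    to-< (x , y , x<y , x↦i , y↦j) =
      subst₂ (λ x y → toℕ x < toℕ y) (position-unique l x x↦i) (position-unique l y y↦j) x<y
    from-< : pos l i < pos l j → Precedes (lookup C l) (label i) (label j)
    from-< i<j = position l i , position l j , i<j , lookup-position l i , lookup-position l j

  compatible : ∀ l {i j} → pos l i < pos l j → lookup (label i) l ≡ plus → lookup (label j) l ≡ plus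
  compatible l {i} {j} i<j i-plus with lookup (label j) l in j-sign
  ... | plus  = refl
  ... | minus = ⊥-elim (C-compatible l (label i) (label j) (Equivalence.from (Precedes⇔< l) i<j) i-plus j-sign)

  open Ranking label pos pos-injective compatible

  lastAxis : Fin (suc d)
  lastAxis = fromℕ d

  record Encodes {n} (π : DPermRaw (suc d) n) (t : KTree k) : Set where
    field
      address          : Fin n → List (Fin k)
      address-internal : ∀ p → Internal t (address p)
      coord≡rank       : ∀ l p → toℕ (coord π l p) ≡ rank l t (address p)
      internals≡       : internals t ≡ n

  module Encoding {n} {π : DPermRaw (suc d) n} {t : KTree k} (E : Encodes π t) where
    open Encodes E

    internal-at : ∀ {p a} → address p ≡ a → Internal t a
    internal-at {p} refl = address-internal p

    coord-at : ∀ l {p a} → address p ≡ a → toℕ (coord π l p) ≡ rank l t a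
    coord-at l {p} refl = coord≡rank l p

    address-injective : Injective _≡_ _≡_ address
    address-injective {p} {q} e = toℕ-injective (trans (coord≡rank zero p) (sym (coord-at zero (sym e))))

    coord-injective : ∀ l → Injective _≡_ _≡_ (coord π l)
    coord-injective l {p} {q} e = address-injective (rank-injective l t (address-internal p) (address-internal q)
      (trans (sym (coord≡rank l p)) (trans (cong toℕ e) (coord≡rank l q))))

    isDPerm : IsDPerm π
    isDPerm l _ _ = coord-injective (suc l)

    address-surjective : ∀ {a} → Internal t a → ∃ λ p → address p ≡ a
    address-surjective {a} ia =
      p , rank-injective zero t (address-internal p) ia (trans (sym (coord≡rank zero p)) (toℕ-fromℕ< _))
      where
      p : Fin n
      p = fromℕ< (subst (rank zero t a <_) internals≡ (rank<internals zero t a ia))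

    Subtree : List (Fin k) → Region n
    Subtree a p = ∃ λ w → address p ≡ a ++ w

    dir-descendant : ∀ {r p a j w} → address r ≡ a → address p ≡ a ++ j ∷ w → dir π r p ≡ label j
    dir-descendant {r} {p} {a} {j} r↦a p↦ = Pointwise-≡⇒≡ (ext same-sign)
      where
      same-sign : ∀ l → lookup (dir π r p) l ≡ sign j l
      same-sign l with sign j l in j-sign
      ... | plus  = Equivalence.from (dir≡plus⇔ π r p l)
          (subst₂ _<_ (sym (coord-at l r↦a)) (sym (coord-at l p↦)) (ancestor<descendant l t a (internal-at p↦) j-sign))
      ... | minus = Equivalence.from (dir≡minus⇔ π r p l) (<⇒≯
          (subst₂ _<_ (sym (coord-at l p↦)) (sym (coord-at l r↦a)) (descendant<ancestor l t a (internal-at p↦) j-sign)))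

    descendant-split : ∀ {r a p} → address r ≡ a → Subtree a p → p ≢ r → ∃₂ λ j w → address p ≡ a ++ j ∷ w
    descendant-split {a = a} r↦a ([] , p↦) p≢r =
      contradiction (address-injective (trans p↦ (trans (++-identityʳ a) (sym r↦a)))) p≢r
    descendant-split r↦a (j ∷ w , p↦) _ = j , w , p↦

    Subtree-root : ∀ {r a} → address r ≡ a → IsRoot π (Subtree a) r
    Subtree-root {r} {a} r↦a = ([] , trans r↦a (sym (++-identityʳ a))) , below-r
      where
      below-r : ∀ p → Subtree a p → toℕ (lastCoord π p) ≤ toℕ (lastCoord π r)
      below-r p p∈a with p Fin.≟ r
      ... | yes refl = ≤-refl
      ... | no p≢r with descendant-split r↦a p∈a p≢r
      ...   | j , _ , p↦ = <⇒≤ (subst₂ _<_ (sym (coord-at lastAxis p↦)) (sym (coord-at lastAxis r↦a))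
                                  (descendant<ancestor lastAxis t a (internal-at p↦) (label-IsF j)))

    root-address : ∀ {S r a} → S ≐ Subtree a → IsRoot π S r → address r ≡ a
    root-address {S} {r} {a} S≐Ta r-root = trans (cong address r≡r₀) r₀↦a
      where
      a-internal : Internal t a
      a-internal = Internal-prefix t a (internal-at (proj₂ (proj₁ S≐Ta (proj₁ r-root))))
      r₀ = proj₁ (address-surjective a-internal)
      r₀↦a = proj₂ (address-surjective a-internal)
      r≡r₀ : r ≡ r₀
      r≡r₀ = coord-injective lastAxis
        (IsRoot-lastCoord π r-root (IsRoot-resp-≐ π (≐-sym S≐Ta) (Subtree-root r₀↦a)))

    child-label : ∀ {r a f p} → address r ≡ a → Child π (Subtree a) r f p →
      ∃ λ j → label j ≡ f × Subtree (a ∷ʳ j) p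
    child-label {a = a} r↦a (p∈a , p≢r , dir≡f) with descendant-split r↦a p∈a p≢r
    ... | j , w , p↦ = j , trans (sym (dir-descendant r↦a p↦)) dir≡f , w , trans p↦ (sym (∷ʳ-++ a j w))

    Child-Subtree : ∀ {r a j} → address r ≡ a → Child π (Subtree a) r (label j) ≐ Subtree (a ∷ʳ j)
    Child-Subtree {r} {a} {j} r↦a = into , onto
      where
      into : Child π (Subtree a) r (label j) ⊆ Subtree (a ∷ʳ j)
      into c with child-label r↦a c
      ... | j′ , j′↦j , p∈a∷ʳj with label-injective j′↦j
      ... | refl = p∈a∷ʳj
      onto : Subtree (a ∷ʳ j) ⊆ Child π (Subtree a) r (label j)
      onto {p} (w , p↦) = (j ∷ w , p↦′) , p≢r , dir-descendant r↦a p↦′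
        where
        p↦′ : address p ≡ a ++ j ∷ w
        p↦′ = trans p↦ (∷ʳ-++ a j w)
        p≢r : p ≢ r
        p≢r refl = contradiction (++-identityʳ-unique a (trans (sym r↦a) p↦′)) λ ()

    Reach-Subtree : ∀ {S} → Reach π S → (∃ λ a → S ≐ Subtree a) ⊎ Empty S
    Reach-Subtree top = inj₁ ([] , (λ {p} _ → address p , refl) , const tt)
    Reach-Subtree (step r f _ reach r-root) with Reach-Subtree reach
    ... | inj₂ S-empty = inj₂ λ p c → S-empty p (proj₁ c)
    ... | inj₁ (a , S≐Ta) with label? f
    ...   | yes (j , refl) = inj₁ (a ∷ʳ j , ≐-trans (Child-resp-≐ π S≐Ta) (Child-Subtree (root-address S≐Ta r-root)))
    ...   | no ∄j = inj₂ λ p c →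
            ∄j (map₂ proj₁ (child-label (root-address S≐Ta r-root) (proj₁ S≐Ta (proj₁ c) , proj₂ c)))

    child-address : ∀ {S r f p} → Reach π S → IsRoot π S r → Child π S r f p →
      ∃₂ λ j w → label j ≡ f × address p ≡ address r ++ j ∷ w
    child-address {r = r} {f} {p} reach r-root c with Reach-Subtree reach
    ... | inj₂ S-empty = contradiction (proj₁ r-root) (S-empty _)
    ... | inj₁ (a , S≐Ta) = located r↦a (child-label r↦a (proj₁ S≐Ta (proj₁ c) , proj₂ c))
      where
      r↦a = root-address S≐Ta r-root
      located : ∀ {a} → address r ≡ a → (∃ λ j → label j ≡ f × Subtree (a ∷ʳ j) p) →
        ∃₂ λ j w → label j ≡ f × address p ≡ address r ++ j ∷ w
      located refl (j , j↦f , w , p↦) = j , w , j↦f , trans p↦ (∷ʳ-++ _ j w)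

    children-ordered : ∀ {S r l f₁ f₂ p q} → Reach π S → IsRoot π S r → Precedes (lookup C l) f₁ f₂ →
      Child π S r f₁ p → Child π S r f₂ q → toℕ (coord π l p) < toℕ (coord π l q)
    children-ordered {r = r} {l} reach r-root f₁≺f₂ c₁ c₂
      with child-address reach r-root c₁ | child-address reach r-root c₂
    ... | j₁ , _ , refl , p↦ | j₂ , _ , refl , q↦ =
      subst₂ _<_ (sym (coord-at l p↦)) (sym (coord-at l q↦))
        (ordered-descendants< l t (address r) (internal-at p↦) (internal-at q↦)
          (Equivalence.to (Precedes⇔< l) f₁≺f₂))

    children-labelled : ∀ {S r f p} → Reach π S → IsRoot π S r → Child π S r f p → f ∈ F
    children-labelled reach r-root c with child-address reach r-root c
    ... | j , _ , refl , _ = ∈-lookup j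

    admissible : Admissible F C π
    admissible = (λ S reach r r-root l f₁ f₂ _ _ f₁≺f₂ p q → children-ordered reach r-root f₁≺f₂)
               , (λ S reach r r-root f _ f∉F p c → f∉F (children-labelled reach r-root c))

  module _ {n} {π : DPermRaw (suc d) n} where
    open Encoding

    -- The point of a subtree region with the largest last coordinate sits at its root, so π
    -- alone locates that root, and with it the child regions.
    Subtree-step : ∀ {t u} (E : Encodes π t) (E′ : Encodes π u) {a} j →
      Subtree E a ≐ Subtree E′ a → Subtree E (a ∷ʳ j) ⊆ Subtree E′ (a ∷ʳ j)
    Subtree-step {t} E E′ {a} j Ta≐ {p} (w , p↦) =
      proj₁ (Child-Subtree E′ r↦′a) (proj₁ Ta≐ (proj₁ c) , proj₂ c)
      where
      a-internal : Internal t a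
      a-internal = Internal-prefix t a (internal-at E (trans p↦ (∷ʳ-++ a j w)))
      r = proj₁ (address-surjective E a-internal)
      r↦a : Encodes.address E r ≡ a
      r↦a = proj₂ (address-surjective E a-internal)
      r↦′a : Encodes.address E′ r ≡ a
      r↦′a = root-address E′ ≐-refl (IsRoot-resp-≐ π Ta≐ (Subtree-root E r↦a))
      c : Child π (Subtree E a) r (label j) p
      c = proj₂ (Child-Subtree E r↦a) (w , p↦)

    Subtree-≐ : ∀ {t u} (E : Encodes π t) (E′ : Encodes π u) c {a} →
      Subtree E a ≐ Subtree E′ a → Subtree E (a ++ c) ≐ Subtree E′ (a ++ c)
    Subtree-≐ E E′ [] {a} Ta≐ = subst (λ b → Subtree E b ≐ Subtree E′ b) (sym (++-identityʳ a)) Ta≐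
    Subtree-≐ E E′ (j ∷ c) {a} Ta≐ = subst (λ b → Subtree E b ≐ Subtree E′ b) (∷ʳ-++ a j c)
      (Subtree-≐ E E′ c (Subtree-step E E′ j Ta≐ , Subtree-step E′ E j (≐-sym Ta≐)))

    Internal-transfer : ∀ {t u} → Encodes π t → Encodes π u → ∀ a → Internal t a → Internal u a
    Internal-transfer {t} {u} E E′ a ia = Internal-prefix u a (internal-at E′ (proj₂ p-in-subtree))
      where
      everything : Subtree E [] ≐ Subtree E′ []
      everything = (λ {p} _ → Encodes.address E′ p , refl) , (λ {p} _ → Encodes.address E p , refl)
      p = proj₁ (address-surjective E ia)
      p-in-subtree : Subtree E′ a p
      p-in-subtree = proj₁ (Subtree-≐ E E′ a everything)
        ([] , trans (proj₂ (address-surjective E ia)) (sym (++-identityʳ a)))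

    Encodes-injective : ∀ {t u} → Encodes π t → Encodes π u → t ≡ u
    Encodes-injective {t} {u} E E′ = Internal-ext t u (Internal-transfer E E′) (Internal-transfer E′ E)

  Encodes-functional : ∀ {n} {π π′ : DPermRaw (suc d) n} {t} → Encodes π t → Encodes π′ t → π ≡ π′
  Encodes-functional {π = π} {π′} {t} E E′ =
    cong mkDPerm (Pointwise-≡⇒≡ (ext λ l → Pointwise-≡⇒≡ (ext λ p → same-coord l p)))
    where
    open Encodes
    same-address : ∀ p → address E p ≡ address E′ p
    same-address p = rank-injective zero t (address-internal E p) (address-internal E′ p)
      (trans (sym (coord≡rank E zero p)) (coord≡rank E′ zero p))
    same-coord : ∀ l p → coord π (suc l) p ≡ coord π′ (suc l) p
    same-coord l p = toℕ-injective (begin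
      toℕ (coord π (suc l) p)               ≡⟨ coord≡rank E (suc l) p ⟩
      rank (suc l) t (address E p)          ≡⟨ cong (rank (suc l) t) (same-address p) ⟩
      rank (suc l) t (address E′ p)         ≡⟨ coord≡rank E′ (suc l) p ⟨
      toℕ (coord π′ (suc l) p)              ∎)
      where open ≡-Reasoning

  module _ (t : KTree k) where
    private
      rank₀ : Fin (internals t) → Fin (internals t)
      rank₀ i = fromℕ< (rank<internals zero t (enumerate t i) (enumerate-internal t i))

      rank₀-injective : Injective _≡_ _≡_ rank₀
      rank₀-injective {i} {j} e = enumerate-injective t
        (rank-injective zero t (enumerate-internal t i) (enumerate-internal t j)
          (trans (sym (toℕ-fromℕ< _)) (trans (cong toℕ e) (toℕ-fromℕ< _))))

      unrank₀ : Fin (internals t) → Fin (internals t)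
      unrank₀ p = proj₁ (injective⇒surjective rank₀ rank₀-injective p)

    nodeAt : Fin (internals t) → List (Fin k)
    nodeAt p = enumerate t (unrank₀ p)

    nodeAt-internal : ∀ p → Internal t (nodeAt p)
    nodeAt-internal p = enumerate-internal t (unrank₀ p)

    rank₀-nodeAt : ∀ p → rank zero t (nodeAt p) ≡ toℕ p
    rank₀-nodeAt p = trans (sym (toℕ-fromℕ< _)) (cong toℕ (proj₂ (injective⇒surjective rank₀ rank₀-injective p)))

    rankAt : Fin (suc d) → Fin (internals t) → Fin (internals t)
    rankAt l p = fromℕ< (rank<internals l t (nodeAt p) (nodeAt-internal p))

    treeDPerm : DPermRaw (suc d) (internals t)
    treeDPerm = mkDPerm (tabulate λ l → tabulate (rankAt (suc l)))

    treeDPerm-encodes : Encodes treeDPerm t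
    treeDPerm-encodes = record
      { address          = nodeAt
      ; address-internal = nodeAt-internal
      ; coord≡rank       = coord≡rank
      ; internals≡       = refl
      }
      where
      coord≡rank : ∀ l p → toℕ (coord treeDPerm l p) ≡ rank l t (nodeAt p)
      coord≡rank zero    p = sym (rank₀-nodeAt p)
      coord≡rank (suc l) p = begin
        toℕ (lookup (lookup (rows treeDPerm) l) p)   ≡⟨ cong (λ row → toℕ (lookup row p)) (lookup∘tabulate _ l) ⟩
        toℕ (lookup (tabulate (rankAt (suc l))) p)   ≡⟨ cong toℕ (lookup∘tabulate _ p) ⟩
        toℕ (rankAt (suc l) p)                       ≡⟨ toℕ-fromℕ< _ ⟩
        rank (suc l) t (nodeAt p)                    ∎
        where open ≡-Reasoning

  toDPerm : ∀ {n} → KTreeN k n → DPermRaw (suc d) n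
  toDPerm (t , refl) = treeDPerm t

  toDPerm-encodes : ∀ {n} (t : KTreeN k n) → Encodes (toDPerm t) (proj₁ t)
  toDPerm-encodes (t , refl) = treeDPerm-encodes t

  module MaxTree {n} (π : DPermRaw (suc d) n) (π-perm : IsDPerm π) (π-admissible : Admissible F C π) where

    private
      c : Fin (suc d) → Fin n → ℕ
      c l p = toℕ (coord π l p)

    coord-injective : ∀ l → Injective _≡_ _≡_ (coord π l)
    coord-injective zero    e = e
    coord-injective (suc l) e = π-perm l _ _ e

    Child? : ∀ {S} → Decidable S → ∀ r j → Decidable (Child π S r (label j))
    Child? S? r j p = S? p ×-dec ¬? (p Fin.≟ r) ×-dec ≡-dec _≟ₛ_ (dir π r p) (label j)

    root? : ∀ {S} → Decidable S → (∃ λ r → IsRoot π S r) ⊎ Empty S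
    root? S? = maximum-or-empty S? (λ p → toℕ (lastCoord π p))

    mutual
      maxTree : ℕ → ∀ {S} → Decidable S → KTree k
      maxTree zero    S? = leaf
      maxTree (suc m) S? = maxTree-at m S? (root? S?)

      maxTree-at : ℕ → ∀ {S} → Decidable S → (∃ λ r → IsRoot π S r) ⊎ Empty S → KTree k
      maxTree-at m S? (inj₁ (r , _)) = node (tabulate λ j → maxTree m (Child? S? r j))
      maxTree-at m S? (inj₂ _)       = leaf

    countBelow : Fin (suc d) → ∀ {S} → Decidable S → Fin n → ℕ
    countBelow l S? p = sumWhere S? λ q → ⟦ c l q <? c l p ⟧

    record EncodesRegion (t : KTree k) {S : Region n} (S? : Decidable S) : Set where
      field
        internals≡count : internals t ≡ count S?
        node-of         : ∀ {p} → S p → ∃ λ a → Internal t a × (∀ l → rank l t a ≡ countBelow l S? p)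

    leaf-encodes-empty : ∀ {S} (S? : Decidable S) → Empty S → EncodesRegion leaf S?
    leaf-encodes-empty S? S-empty = record
      { internals≡count = sym (sum-zero λ q → cong (_* 1) (⟦⟧-no (S? q) (S-empty q)))
      ; node-of         = λ {p} Sp → contradiction Sp (S-empty p)
      }

    module AtRoot {S : Region n} (S? : Decidable S) (reach : Reach π S) {r} (r-root : IsRoot π S r) where

      child : Fin k → Region n
      child j = Child π S r (label j)

      child? : ∀ j → Decidable (child j)
      child? = Child? S? r

      childCount : Fin k → ℕ
      childCount j = count (child? j)

      child-reach : ∀ j → Reach π (child j)
      child-reach j = step r (label j) (label-IsF j) reach r-root

      child-unique : ∀ {q i j} → child i q → child j q → i ≡ j
      child-unique (_ , _ , q↦i) (_ , _ , q↦j) = label-injective (trans (sym q↦i) q↦j)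

      child-exists : ∀ {q} → S q → q ≢ r → ∃ λ j → child j q
      child-exists {q} Sq q≢r with label? (dir π r q)
      ... | yes (j , j↦) = j , Sq , q≢r , sym j↦
      ... | no ∄j = contradiction (Sq , q≢r , refl)
          (proj₂ π-admissible S reach r r-root (dir π r q) dir-IsF (∄j ∘ ∈⇒label) q)
        where
        dir-IsF : IsF (dir π r q)
        dir-IsF = Equivalence.from (dir≡minus⇔ π r q lastAxis) (≤⇒≯ (proj₂ r-root q Sq))

      partition : ∀ q → ⟦ S? q ⟧ ≡ ⟦ q Fin.≟ r ⟧ + sum (λ j → ⟦ child? j q ⟧)
      partition q = by-cases q (q Fin.≟ r) (S? q)
        where
        -- A helper instead of with-abstracting q Fin.≟ r, which would also hit the copy inside child? j q.
        by-cases : ∀ q → Dec (q ≡ r) → Dec (S q) → ⟦ S? q ⟧ ≡ ⟦ q Fin.≟ r ⟧ + sum (λ j → ⟦ child? j q ⟧)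
        by-cases q (yes refl) _ = trans (⟦⟧-yes (S? r) (proj₁ r-root)) (sym (cong₂ _+_ (⟦⟧-yes (r Fin.≟ r) refl)
          (sum-zero λ j → ⟦⟧-no (child? j r) λ c → proj₁ (proj₂ c) refl)))
        by-cases q (no q≢r) (no ¬Sq) = trans (⟦⟧-no (S? q) ¬Sq) (sym (cong₂ _+_ (⟦⟧-no (q Fin.≟ r) q≢r)
          (sum-zero λ j → ⟦⟧-no (child? j q) (¬Sq ∘ proj₁))))
        by-cases q (no q≢r) (yes Sq) = trans (⟦⟧-yes (S? q) Sq) (sym (cong₂ _+_ (⟦⟧-no (q Fin.≟ r) q≢r)
          (trans (sum-single _ j₀ λ j j≢j₀ → ⟦⟧-no (child? j q) λ cq → j≢j₀ (child-unique cq q∈j₀))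
                 (⟦⟧-yes (child? j₀ q) q∈j₀))))
          where
          j₀ = proj₁ (child-exists Sq q≢r)
          q∈j₀ = proj₂ (child-exists Sq q≢r)

      split : (w : Fin n → ℕ) → sumWhere S? w ≡ w r + sum (λ j → sumWhere (child? j) w)
      split w = begin
        sum (λ q → ⟦ S? q ⟧ * w q)
          ≡⟨ sum-cong-≗ (λ q → trans (cong (_* w q) (partition q)) (*-distribʳ-+ (w q) ⟦ q Fin.≟ r ⟧ _)) ⟩
        sum (λ q → ⟦ q Fin.≟ r ⟧ * w q + sum (λ j → ⟦ child? j q ⟧) * w q)
          ≡⟨ ∑-distrib-+ (λ q → ⟦ q Fin.≟ r ⟧ * w q) _ ⟩
        sumWhere (Fin._≟ r) w + sum (λ q → sum (λ j → ⟦ child? j q ⟧) * w q)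
          ≡⟨ cong₂ _+_ (sumWhere-≟ w r) (sum-cong-≗ λ q → *-distribʳ-sum {k} (w q) (λ j → ⟦ child? j q ⟧)) ⟩
        w r + sum (λ q → sum (λ j → ⟦ child? j q ⟧ * w q))
          ≡⟨ cong (w r +_) (∑-comm (λ q j → ⟦ child? j q ⟧ * w q)) ⟩
        w r + sum (λ j → sumWhere (child? j) w) ∎
        where open ≡-Reasoning

      sign-child : ∀ {j q} → child j q → ∀ l → lookup (dir π r q) l ≡ sign j l
      sign-child (_ , _ , q↦j) l = cong (λ f → lookup f l) q↦j

      ⟦below-root⟧ : ∀ l {j q} → child j q → ⟦ c l q <? c l r ⟧ ≡ ⟦ sign j l ≟ₛ minus ⟧
      ⟦below-root⟧ l {j} {q} cq@(_ , q≢r , _) = ⟦⟧-cong (c l q <? c l r) (sign j l ≟ₛ minus) below⇒minus minus⇒below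
        where
        below⇒minus : c l q < c l r → sign j l ≡ minus
        below⇒minus q<r = trans (sym (sign-child cq l)) (Equivalence.from (dir≡minus⇔ π r q l) (<⇒≯ q<r))
        minus⇒below : sign j l ≡ minus → c l q < c l r
        minus⇒below j-minus = ≤∧≢⇒< (≮⇒≥ (Equivalence.to (dir≡minus⇔ π r q l) (trans (sign-child cq l) j-minus)))
                                    (q≢r ∘ coord-injective l ∘ toℕ-injective)

      ⟦root-below⟧ : ∀ l {j p} → child j p → ⟦ c l r <? c l p ⟧ ≡ ⟦ sign j l ≟ₛ plus ⟧
      ⟦root-below⟧ l {j} {p} cp = ⟦⟧-cong (c l r <? c l p) (sign j l ≟ₛ plus)
        (λ r<p → trans (sym (sign-child cp l)) (Equivalence.from (dir≡plus⇔ π r p l) r<p))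
        (λ j-plus → Equivalence.to (dir≡plus⇔ π r p l) (trans (sign-child cp l) j-plus))

      ⟦sibling-below⟧ : ∀ l {i j p q} → i ≢ j → child i q → child j p →
        ⟦ c l q <? c l p ⟧ ≡ ⟦ pos l i <? pos l j ⟧
      ⟦sibling-below⟧ l {i} {j} {p} {q} i≢j cq cp =
        ⟦⟧-cong (c l q <? c l p) (pos l i <? pos l j) below⇒≺ (ordered l cq cp)
        where
        ordered : ∀ l {i j p q} → child i q → child j p → pos l i < pos l j → c l q < c l p
        ordered l {i} {j} {p} {q} cq cp i≺j = proj₁ π-admissible S reach r r-root l (label i) (label j)
          (∈-lookup i) (∈-lookup j) (Equivalence.from (Precedes⇔< l) i≺j) q p cq cp
        below⇒≺ : c l q < c l p → pos l i < pos l j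
        below⇒≺ q<p with ≺-total l i≢j
        ... | inj₁ i≺j = i≺j
        ... | inj₂ j≺i = contradiction (ordered l cp cq j≺i) (<⇒≯ q<p)

      countBelow-root : ∀ l → countBelow l S? r ≡ rootRank l childCount
      countBelow-root l = begin
        countBelow l S? r
          ≡⟨ split _ ⟩
        ⟦ c l r <? c l r ⟧ + sum (λ j → sumWhere (child? j) λ q → ⟦ c l q <? c l r ⟧)
          ≡⟨ cong₂ _+_ (⟦⟧-no (c l r <? c l r) (<-irrefl refl))
                       (sum-cong-≗ λ j → sumWhere-const (child? j) _ (⟦below-root⟧ l)) ⟩
        rootRank l childCount ∎
        where open ≡-Reasoning

      countBelow-child : ∀ l {j₀ p} → child j₀ p → countBelow l S? p ≡
        preceding l childCount j₀ + ⟦ sign j₀ l ≟ₛ plus ⟧ + countBelow l (child? j₀) p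
      countBelow-child l {j₀} {p} cp = begin
        countBelow l S? p
          ≡⟨ split _ ⟩
        ⟦ c l r <? c l p ⟧ + sum X
          ≡⟨ cong₂ _+_ (⟦root-below⟧ l cp) (sum-cong-≗ X-split) ⟩
        ⟦ sign j₀ l ≟ₛ plus ⟧ + sum (λ j → ⟦ pos l j <? pos l j₀ ⟧ * childCount j + ⟦ j Fin.≟ j₀ ⟧ * X j)
          ≡⟨ cong (⟦ sign j₀ l ≟ₛ plus ⟧ +_) (∑-distrib-+ (λ j → ⟦ pos l j <? pos l j₀ ⟧ * childCount j) _) ⟩
        ⟦ sign j₀ l ≟ₛ plus ⟧ + (preceding l childCount j₀ + sumWhere (Fin._≟ j₀) X)
          ≡⟨ cong (λ x → ⟦ sign j₀ l ≟ₛ plus ⟧ + (_ + x)) (sumWhere-≟ X j₀) ⟩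
        ⟦ sign j₀ l ≟ₛ plus ⟧ + (preceding l childCount j₀ + X j₀)
          ≡⟨ x∙yz≈yx∙z ⟦ sign j₀ l ≟ₛ plus ⟧ (preceding l childCount j₀) (X j₀) ⟩
        preceding l childCount j₀ + ⟦ sign j₀ l ≟ₛ plus ⟧ + X j₀ ∎
        where
        open ≡-Reasoning
        X : Fin k → ℕ
        X j = sumWhere (child? j) λ q → ⟦ c l q <? c l p ⟧
        X-split : ∀ j → X j ≡ ⟦ pos l j <? pos l j₀ ⟧ * childCount j + ⟦ j Fin.≟ j₀ ⟧ * X j
        X-split j with j Fin.≟ j₀
        ... | yes refl = sym (trans
          (cong (λ b → b * childCount j₀ + 1 * X j₀) (⟦⟧-no (pos l j₀ <? pos l j₀) (<-irrefl refl)))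
          (+-identityʳ (X j₀)))
        ... | no j≢j₀ = trans (sumWhere-const (child? j) _ λ cq → ⟦sibling-below⟧ l j≢j₀ cq cp) (sym (+-identityʳ _))

      node-encodes : (ts : Vec (KTree k) k) → (∀ j → EncodesRegion (lookup ts j) (child? j)) →
        EncodesRegion (node ts) S?
      node-encodes ts sub = record { internals≡count = internals≡count ; node-of = node-of }
        where
        open ≡-Reasoning
        size≡count : ∀ j → size ts j ≡ childCount j
        size≡count j = EncodesRegion.internals≡count (sub j)
        internals≡count : internals (node ts) ≡ count S?
        internals≡count = begin
          suc (internalsV ts)                      ≡⟨ cong suc (internalsV≡sum ts) ⟩
          suc (sum (size ts))                      ≡⟨ cong suc (sum-cong-≗ size≡count) ⟩
          suc (sum childCount)                     ≡⟨ split (λ _ → 1) ⟨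
          count S?                                 ∎
        node-of : ∀ {p} → S p → ∃ λ a → Internal (node ts) a × (∀ l → rank l (node ts) a ≡ countBelow l S? p)
        node-of {p} Sp with p Fin.≟ r
        ... | yes refl = [] , tt , λ l →
          trans (sumWhere-cong (λ j → sign j l ≟ₛ minus) size≡count) (sym (countBelow-root l))
        ... | no p≢r with child-exists Sp p≢r
        ...   | j₀ , p∈j₀ with EncodesRegion.node-of (sub j₀) p∈j₀
        ...     | a , a-internal , rank≡ = j₀ ∷ a , a-internal , λ l → begin
          preceding l (size ts) j₀ + ⟦ sign j₀ l ≟ₛ plus ⟧ + rank l (lookup ts j₀) a
            ≡⟨ cong₂ _+_ (cong (_+ ⟦ sign j₀ l ≟ₛ plus ⟧) (sumWhere-cong (λ j → pos l j <? pos l j₀) size≡count))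
                         (rank≡ l) ⟩
          preceding l childCount j₀ + ⟦ sign j₀ l ≟ₛ plus ⟧
            + countBelow l (child? j₀) p
            ≡⟨ countBelow-child l p∈j₀ ⟨
          countBelow l S? p ∎

      child-count≤ : ∀ {m} → count S? ≤ suc m → ∀ j → childCount j ≤ m
      child-count≤ count≤ j = ≤-trans (≤-sum childCount j)
        (s≤s⁻¹ (≤-trans (≤-reflexive (sym (split (λ _ → 1)))) count≤))

    mutual
      maxTree-encodes-region : ∀ m {S} (S? : Decidable S) → Reach π S → count S? ≤ m →
        EncodesRegion (maxTree m S?) S?
      maxTree-encodes-region zero    S? _     count≤0 =
        leaf-encodes-empty S? λ p Sp → <⇒≱ (count-positive S? Sp) count≤0
      maxTree-encodes-region (suc m) S? reach count≤ = maxTree-at-encodes m S? reach count≤ (root? S?)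

      maxTree-at-encodes : ∀ m {S} (S? : Decidable S) → Reach π S → count S? ≤ suc m →
        (root : (∃ λ r → IsRoot π S r) ⊎ Empty S) → EncodesRegion (maxTree-at m S? root) S?
      maxTree-at-encodes m S? reach count≤ (inj₁ (r , r-root)) =
        node-encodes (tabulate λ j → maxTree m (child? j)) λ j →
          subst (λ t → EncodesRegion t (child? j)) (sym (lookup∘tabulate _ j))
            (maxTree-encodes-region m (child? j) (child-reach j) (child-count≤ count≤ j))
        where open AtRoot S? reach r-root
      maxTree-at-encodes m S? _ _ (inj₂ S-empty) = leaf-encodes-empty S? S-empty

    maxTree-encodes : Encodes π (maxTree n U?)
    maxTree-encodes = record
      { address          = λ p → proj₁ (node-of {p} tt)
      ; address-internal = λ p → proj₁ (proj₂ (node-of {p} tt))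
      ; coord≡rank       = λ l p → sym (trans (proj₂ (proj₂ (node-of {p} tt)) l) (countBelow-U l p))
      ; internals≡       = trans internals≡count count-U
      }
      where
      open EncodesRegion (maxTree-encodes-region n U? top (≤-reflexive count-U))
      countBelow-U : ∀ l p → countBelow l U? p ≡ c l p
      countBelow-U l p = trans (sum-cong-≗ λ q → *-identityˡ ⟦ c l q <? c l p ⟧)
        (count-below-injective (coord π l) (coord-injective l) (c l p) (<⇒≤ (toℕ<n (coord π l p))))

corollary1 : (d n k : ℕ) → 2 ≤ d →
    (F : List (Dir d)) → Unique F → All IsF F → length F ≡ k →
    (C : Vec (List (Dir d)) d) → (∀ (l : Fin d) → lookup C l ↭ F) → Compatible C →
    Σ[ φ ∈ (KTreeN k n → DPermRaw d n) ]
      ((∀ t → IsDPerm (φ t) × Admissible F C (φ t))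
      × (∀ t u → φ t ≡ φ u → t ≡ u)
      × (∀ π → IsDPerm π → Admissible F C π → ∃[ t ] φ t ≡ π))
corollary1 (suc d) n .(length F) _ F F-unique F-directions refl C C↭F C-compatible =
  toDPerm , image-admissible , injective , surjective
  where
  open Bijection F F-unique F-directions C C↭F C-compatible
  image-admissible : ∀ t → IsDPerm (toDPerm t) × Admissible F C (toDPerm t)
  image-admissible t = Encoding.isDPerm (toDPerm-encodes t) , Encoding.admissible (toDPerm-encodes t)
  injective : ∀ t u → toDPerm t ≡ toDPerm u → t ≡ u
  injective t u φt≡φu = KTreeN-≡ (Encodes-injective (toDPerm-encodes t)
    (subst (λ π → Encodes π (proj₁ u)) (sym φt≡φu) (toDPerm-encodes u)))
  surjective : ∀ π → IsDPerm π → Admissible F C π → ∃[ t ] toDPerm t ≡ π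
  surjective π π-perm π-admissible =
    (maxTree n U? , Encodes.internals≡ maxTree-encodes) , Encodes-functional (toDPerm-encodes _) maxTree-encodes
    where open MaxTree π π-perm π-admissible
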